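{- Let $M \subset \mathbb{A}^3$ be the affine Markoff surface $x^2+y^2+z^2 = xyz$, and let $\phi_1,\phi_2,\phi_3$ be its automorphisms $\phi_1(x,y,z) = (yz-x,\,y,\,z)$, $\phi_2(x,y,z) = (x,\,xz-y,\,z)$, $\phi_3(x,y,z) = (x,\,y,\,xy-z)$. Fix distinct $i,j \in \{1,2,3\}$ and put $f = \phi_i\circ\phi_j$, with forbidden set $\mathcal{F}_1 = \{(0,0,0)\}$. Then: (1) There exists a finite set $S$ of primes such that for every prime $p \notin S$ there is a point $P \in M(\mathbb{F}_p)$ with $P \neq (0,0,0)$ and $f_p^n(P) = P$ for some integer $1 \le n \le 3$; that is, the system $(M, f, \mathcal{F}_1)$ is strongly residually periodic over $\mathbb{Q}$ with bound $3$. (2) The bound $3$ is sharp: there is no finite set $S$ of primes such that for every prime $p\notin S$ there is a point $P \in M(\mathbb{F}_p)$ with $P \neq (0,0,0)$ and $f_p^n(P)=P$ for some $1 \le n \le 2$.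
   Context: For a prime $p$, $M(\mathbb{F}_p)$ denotes the set of $(x,y,z)\in\mathbb{F}_p^3$ with $x^2+y^2+z^2=xyz$ in $\mathbb{F}_p$, and $f_p$ denotes the map on $M(\mathbb{F}_p)$ given by the same polynomial formulas as $f$, reduced modulo $p$. In general, a dynamical system $(X,f,\mathcal{F})$ over $\mathbb{Q}$ (variety $X$, endomorphism $f$, algebraic "forbidden" subset $\mathcal{F}$) is called strongly residually periodic with bound $B$ (SRP($B$)) if there is a finite set of primes $S$ such that for every prime $p\notin S$ the reduction $f_p$ has an $\mathbb{F}_p$-point $P$ of $X_p$ with $f_p^n(P)=P$ for some $1\le n\le B$ and $P$ not in the reduction modulo $p$ of $\mathcal{F}$. -}

module Defs where

open import Data.Nat using (ℕ; zero; suc; _+_; _*_; _∸_; _<_; _≤_; NonZero)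
open import Data.Nat.DivMod using (_%_)
open import Data.Nat.Primality using (Prime; prime⇒nonZero)
open import Data.Fin using (Fin)
open import Data.Product using (_×_; _,_; Σ; ∃; ∃-syntax)
open import Data.List using (List)
open import Data.List.Membership.Propositional using (_∈_)
open import Relation.Binary.PropositionalEquality using (_≡_)
open import Relation.Nullary using (¬_)

-- Elements of 𝔽_p are represented by their canonical residues 0 ≤ a < p.
-- A triple (x,y,z) of naturals is an element of 𝔽_p³ when x,y,z < p.
Pt : Set
Pt = ℕ × ℕ × ℕ

InFp³ : ℕ → Pt → Set
InFp³ p (x , y , z) = (x < p) × (y < p) × (z < p)

OnMarkoff : (p : ℕ) → .{{NonZero p}} → Pt → Set
OnMarkoff p (x , y , z) = (x * x + y * y + z * z) % p ≡ (x * y * z) % p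

subp : (p : ℕ) → .{{NonZero p}} → ℕ → ℕ → ℕ
subp p a b = (a + (p ∸ (b % p))) % p

-- The automorphisms φ₁, φ₂, φ₃ reduced mod p (indexed by Fin 3: 0 ↦ φ₁ etc.)
φ : (p : ℕ) → .{{NonZero p}} → Fin 3 → Pt → Pt
φ p Fin.zero (x , y , z) = (subp p (y * z) x , y % p , z % p)
φ p (Fin.suc Fin.zero) (x , y , z) = (x % p , subp p (x * z) y , z % p)
φ p (Fin.suc (Fin.suc Fin.zero)) (x , y , z) = (x % p , y % p , subp p (x * y) z)

f : (p : ℕ) → .{{NonZero p}} → Fin 3 → Fin 3 → Pt → Pt
f p i j P = φ p i (φ p j P)

iterate : {A : Set} → (A → A) → ℕ → A → A
iterate g zero a = a
iterate g (suc n) a = g (iterate g n a)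

HasGoodPeriodicPoint : ℕ → (p : ℕ) → .{{NonZero p}} → Fin 3 → Fin 3 → Set
HasGoodPeriodicPoint B p i j =
  ∃[ P ] (InFp³ p P × OnMarkoff p P × ¬ (P ≡ (0 , 0 , 0)) ×
          ∃[ n ] (1 ≤ n × n ≤ B × iterate (f p i j) n P ≡ P))

SRP : ℕ → Fin 3 → Fin 3 → Set
SRP B i j =
  ∃[ S ] ((∀ q → q ∈ S → Prime q) ×
          ((p : ℕ) → (pp : Prime p) → ¬ (p ∈ S) →
             HasGoodPeriodicPoint B p {{prime⇒nonZero pp}} i j))

module Submission where

-- Relabelling coordinates conjugates φᵢ ∘ φⱼ into φ_σ(i) ∘ φ_σ(j), and the two transpositions
-- swapping x, y and y, z generate S₃, which acts transitively on ordered pairs; so only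
-- f = φ₁ ∘ φ₂ has to be studied.  On the plane z = c this f is linear in (x, y), with
-- determinant 1 and trace c² − 2.
--
-- For c = 1 it has order 3, and the slice x² + y² + 1 = xy of M is a conic which has an
-- 𝔽_p-point for every p > 3: completing the square turns it into u² + 3v² = −4, and the
-- (p + 1)/2 values u² and the (p + 1)/2 values −4 − 3v² must meet.  Hence S = {2, 3} works
-- for the bound 3.
--
-- A point of period at most 2 satisfies f² = (c² − 2) f − 1 (Cayley–Hamilton), which together
-- with the Markoff equation forces c = 0 when p is odd, and then x² + y² = 0.  When
-- p ≡ 3 (mod 4), −1 is not a square (Fermat), so the point is the origin.  Since any finite
-- set of primes misses a prime ≡ 3 (mod 4) (a prime factor of 4 ∏ S − 1), the bound 2 fails.

open import Defs
open import Level using (0ℓ)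
open import Algebra.Bundles using (CommutativeRing)
open import Data.Nat as ℕ using (ℕ; zero; suc; NonZero; _!)
import Data.Nat.Properties as ℕ
open import Data.Nat.DivMod using (_%_; _/_; m%n<n; m≡m%n+[m/n]*n; %-distribˡ-*; [m+kn]%n≡m%n; m/n*n≡m)
open import Data.Nat.Divisibility using (_∣_; divides; ∣⇒≤; ∣1⇒≡1; m∣m*n; ∣m⇒∣m*n; ∣m+n∣m⇒∣n)
open import Data.Nat.Primality
  using ( Prime; euclidsLemma; prime⇒nonZero; prime⇒nonTrivial; prime⇒irreducible; prime[2]; prime?
        ; productOfPrimes≥1)
open import Data.Nat.Primality.Factorisation using (factorise; PrimeFactorisation)
open import Data.Nat.Combinatorics using (_C_; nCn≡1; k![n∸k]!∣n!)
open import Data.Nat.Combinatorics.Specification using (nCk≡n!/k![n-k]!)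
open import Data.Nat.ListAction using (product)
open import Data.Nat.ListAction.Properties using (∈⇒∣product)
import Data.Nat.Tactic.RingSolver as ℕ-Solver
open import Data.Integer as ℤ using (ℤ; +_; _+_; _*_; _-_; -_)
import Data.Integer.Properties as ℤ
open import Data.Integer.DivMod using (_%ℕ_; _/ℕ_; a≡a%ℕn+[a/ℕn]*n; n%ℕd<d)
open import Data.Integer.Divisibility.Signed as Signed
  using (_∣?_; ∣m∣n⇒∣m+n; ∣m⇒∣-m; ∣n⇒∣m*n; ∣⇒∣ᵤ; ∣ᵤ⇒∣)
open import Data.Integer.Tactic.RingSolver using (solve-∀)
open import Data.Fin using (Fin; zero; suc; toℕ; inject₁; fromℕ; fromℕ<)
open import Data.Fin.Patterns using (0F; 1F; 2F)
open import Data.Fin.Properties using (toℕ<n; toℕ-inject₁; toℕ-fromℕ; toℕ-fromℕ<; pigeonhole)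
open import Data.Vec.Functional using (Vector)
open import Data.List using ([]; _∷_)
open import Data.List.Membership.Propositional using (_∈_)
open import Data.List.Relation.Unary.Any using (here; there)
import Data.List.Relation.Unary.All as All
open import Data.Product using (_×_; _,_; ∃; ∃₂; proj₁; proj₂)
open import Data.Sum using (_⊎_; inj₁; inj₂; [_,_]′)
open import Data.Empty using (⊥; ⊥-elim)
open import Function using (_∘_; id; _⇔_; mk⇔; Equivalence)
open import Relation.Nullary using (¬_; Dec; yes; no)
open import Relation.Nullary.Decidable using (map′; from-yes)
open import Relation.Binary.PropositionalEquality
  using (_≡_; _≢_; refl; sym; trans; cong; cong₂; subst; subst₂; module ≡-Reasoning)

-- Arithmetic modulo p

module Congruence (p : ℕ) where

  -- A record rather than a synonym for + p ∣ a - b, so that a and b stay inferable.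
  infix 4 _≈_
  record _≈_ (a b : ℤ) : Set where
    constructor mod
    field divides-difference : + p Signed.∣ a - b

  ≈-reflexive : ∀ {a b} → a ≡ b → a ≈ b
  ≈-reflexive {a} refl = mod (Signed.divides (+ 0) (self-difference a))
    where
    self-difference : ∀ a → a - a ≡ + 0 * + p
    self-difference = solve-∀

  ≈-refl : ∀ {a} → a ≈ a
  ≈-refl = ≈-reflexive refl

  ≈-sym : ∀ {a b} → a ≈ b → b ≈ a
  ≈-sym {a} {b} (mod d) = mod (subst (+ p Signed.∣_) (negate a b) (∣m⇒∣-m d))
    where
    negate : ∀ a b → - (a - b) ≡ b - a
    negate = solve-∀

  ≈-trans : ∀ {a b c} → a ≈ b → b ≈ c → a ≈ c
  ≈-trans {a} {b} {c} (mod d) (mod e) = mod (subst (+ p Signed.∣_) (telescope a b c) (∣m∣n⇒∣m+n d e))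
    where
    telescope : ∀ a b c → (a - b) + (b - c) ≡ a - c
    telescope = solve-∀

  +-cong : ∀ {a b c d} → a ≈ b → c ≈ d → a + c ≈ b + d
  +-cong {a} {b} {c} {d} (mod e) (mod f) = mod (subst (+ p Signed.∣_) (regroup a b c d) (∣m∣n⇒∣m+n e f))
    where
    regroup : ∀ a b c d → (a - b) + (c - d) ≡ (a + c) - (b + d)
    regroup = solve-∀

  *-cong : ∀ {a b c d} → a ≈ b → c ≈ d → a * c ≈ b * d
  *-cong {a} {b} {c} {d} (mod e) (mod f) =
    mod (subst (+ p Signed.∣_) (regroup a b c d) (∣m∣n⇒∣m+n (Signed.∣m⇒∣m*n c e) (∣n⇒∣m*n b f)))
    where
    regroup : ∀ a b c d → (a - b) * c + b * (c - d) ≡ a * c - b * d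
    regroup = solve-∀

  -‿cong : ∀ {a b} → a ≈ b → - a ≈ - b
  -‿cong {a} {b} (mod e) = mod (subst (+ p Signed.∣_) (regroup a b) (∣m⇒∣-m e))
    where
    regroup : ∀ a b → - (a - b) ≡ - a - - b
    regroup = solve-∀

  ℤ/p : CommutativeRing 0ℓ 0ℓ
  ℤ/p = record
    { Carrier = ℤ ; _≈_ = _≈_ ; _+_ = _+_ ; _*_ = _*_ ; -_ = -_ ; 0# = + 0 ; 1# = + 1
    ; isCommutativeRing = record
      { isRing = record
        { +-isAbelianGroup = record
          { isGroup = record
            { isMonoid = record
              { isSemigroup = record
                { isMagma = record
                  { isEquivalence = record { refl = ≈-refl ; sym = ≈-sym ; trans = ≈-trans }
                  ; ∙-cong = +-cong }
                ; assoc = λ a b c → ≈-reflexive (ℤ.+-assoc a b c) }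
              ; identity = (λ a → ≈-reflexive (ℤ.+-identityˡ a)) , (λ a → ≈-reflexive (ℤ.+-identityʳ a)) }
            ; inverse = (λ a → ≈-reflexive (ℤ.+-inverseˡ a)) , (λ a → ≈-reflexive (ℤ.+-inverseʳ a))
            ; ⁻¹-cong = -‿cong }
          ; comm = λ a b → ≈-reflexive (ℤ.+-comm a b) }
        ; *-cong = *-cong
        ; *-assoc = λ a b c → ≈-reflexive (ℤ.*-assoc a b c)
        ; *-identity = (λ a → ≈-reflexive (ℤ.*-identityˡ a)) , (λ a → ≈-reflexive (ℤ.*-identityʳ a))
        ; distrib = (λ a b c → ≈-reflexive (ℤ.*-distribˡ-+ a b c))
                  , (λ a b c → ≈-reflexive (ℤ.*-distribʳ-+ a b c)) }
      ; *-comm = λ a b → ≈-reflexive (ℤ.*-comm a b) } }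

  open CommutativeRing ℤ/p using (setoid; semiring)
  open import Relation.Binary.Reasoning.Setoid setoid
  open import Algebra.Properties.Semiring.Exp semiring using (_^_; ^-assocʳ)
  open import Algebra.Properties.Semiring.Mult semiring using () renaming (_×_ to _·_)
  open import Algebra.Properties.Monoid.Sum (CommutativeRing.+-monoid ℤ/p)
    using (sum; sum-init-last; sum-cong-≋; sum-replicate-zero)

  p≈0 : + p ≈ + 0
  p≈0 = mod (Signed.divides (+ 1) (minus-zero (+ p)))
    where
    minus-zero : ∀ a → a - + 0 ≡ + 1 * a
    minus-zero = solve-∀

  multiple≈0 : ∀ q → q * + p ≈ + 0
  multiple≈0 q = ≈-trans (*-cong (≈-refl {q}) p≈0) (≈-reflexive (ℤ.*-zeroʳ q))

  difference≈0⇒≈ : ∀ {a b} → a - b ≈ + 0 → a ≈ b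
  difference≈0⇒≈ {a} {b} (mod d) = mod (subst (+ p Signed.∣_) (ℤ.+-identityʳ (a - b)) d)

  ≈⇒difference≈0 : ∀ {a b} → a ≈ b → a - b ≈ + 0
  ≈⇒difference≈0 {a} {b} (mod d) = mod (subst (+ p Signed.∣_) (sym (ℤ.+-identityʳ (a - b))) d)

  infix 4 _≈?_
  _≈?_ : ∀ a b → Dec (a ≈ b)
  a ≈? b = map′ mod _≈_.divides-difference (+ p ∣? a - b)

  ·-≈-* : ∀ n a → n · a ≈ + n * a
  ·-≈-* zero    a = ≈-refl
  ·-≈-* (suc n) a = ≈-trans (+-cong (≈-refl {a}) (·-≈-* n a)) (≈-reflexive (sym (successor a (+ n))))
    where
    successor : ∀ a b → (+ 1 + b) * a ≡ a + b * a
    successor = solve-∀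

  multiple-·≈0 : ∀ {n} a → p ∣ n → n · a ≈ + 0
  multiple-·≈0 a (divides q refl) = begin
    (q ℕ.* p) · a     ≈⟨ ·-≈-* (q ℕ.* p) a ⟩
    + (q ℕ.* p) * a   ≡⟨ cong (_* a) (ℤ.pos-* q p) ⟩
    + q * + p * a     ≈⟨ *-cong (multiple≈0 (+ q)) (≈-refl {a}) ⟩
    + 0 * a           ≡⟨ ℤ.*-zeroˡ a ⟩
    + 0               ∎

  sum-with-vanishing-interior : ∀ {n} (t : Vector ℤ (suc (suc n))) → (∀ i → t (suc (inject₁ i)) ≈ + 0) →
                                sum t ≈ t zero + t (fromℕ (suc n))
  sum-with-vanishing-interior {n} t interior = begin
    t zero + sum (t ∘ suc)
      ≈⟨ +-cong (≈-refl {t zero}) (sum-init-last (t ∘ suc)) ⟩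
    t zero + (sum (λ i → t (suc (inject₁ i))) + t (fromℕ (suc n)))
      ≈⟨ +-cong (≈-refl {t zero}) (+-cong vanishing (≈-refl {t (fromℕ (suc n))})) ⟩
    t zero + (+ 0 + t (fromℕ (suc n)))
      ≡⟨ cong (λ s → t zero + s) (ℤ.+-identityˡ _) ⟩
    t zero + t (fromℕ (suc n)) ∎
    where
    vanishing : sum (λ i → t (suc (inject₁ i))) ≈ + 0
    vanishing = ≈-trans (sum-cong-≋ interior) (sum-replicate-zero n)

  odd-power-neg : ∀ a k → (- a) ^ suc (2 ℕ.* k) ≈ - (a ^ suc (2 ℕ.* k))
  odd-power-neg a k = begin
    - a * (- a) ^ (2 ℕ.* k)      ≈⟨ *-cong (≈-refl { - a}) (≈-sym (^-assocʳ (- a) 2 k)) ⟩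
    - a * ((- a) ^ 2) ^ k        ≡⟨ cong (λ s → - a * s ^ k) (square-neg a) ⟩
    - a * (a ^ 2) ^ k            ≈⟨ *-cong (≈-refl { - a}) (^-assocʳ a 2 k) ⟩
    - a * a ^ (2 ℕ.* k)          ≡⟨ ℤ.neg-distribˡ-* a _ ⟨
    - (a * a ^ (2 ℕ.* k))        ∎
    where
    square-neg : ∀ a → (- a) * ((- a) * + 1) ≡ a * (a * + 1)
    square-neg = solve-∀

module Residues (p : ℕ) .{{_ : NonZero p}} where
  open Congruence p
  open import Relation.Binary.Reasoning.Setoid (CommutativeRing.setoid ℤ/p)

  %ℕ-≈ : ∀ a → + (a %ℕ p) ≈ a
  %ℕ-≈ a = ≈-sym (begin
    a                         ≡⟨ a≡a%ℕn+[a/ℕn]*n a p ⟩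
    + (a %ℕ p) + a /ℕ p * + p ≈⟨ +-cong (≈-refl {+ (a %ℕ p)}) (multiple≈0 (a /ℕ p)) ⟩
    + (a %ℕ p) + + 0          ≡⟨ ℤ.+-identityʳ _ ⟩
    + (a %ℕ p)                ∎)

  private
    ordered-residue-injective : ∀ {a b} → b ℕ.≤ a → a ℕ.< p → + a ≈ + b → a ≡ b
    ordered-residue-injective {a} {b} b≤a a<p (mod p∣a-b) with a ℕ.∸ b in a∸b≡ | ∣⇒∣ᵤ (subst (+ p Signed.∣_) a-b≡ p∣a-b)
      where
      a-b≡ : + a - + b ≡ + (a ℕ.∸ b)
      a-b≡ = trans (ℤ.m-n≡m⊖n a b) (ℤ.⊖-≥ b≤a)
    ... | zero  | _     = ℕ.≤-antisym (ℕ.m∸n≡0⇒m≤n a∸b≡) b≤a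
    ... | suc _ | p∣a∸b =
      ⊥-elim (ℕ.<⇒≱ a<p (ℕ.≤-trans (∣⇒≤ p∣a∸b) (subst (ℕ._≤ a) a∸b≡ (ℕ.m∸n≤m a b))))

  residue-injective : ∀ {a b} → a ℕ.< p → b ℕ.< p → + a ≈ + b → a ≡ b
  residue-injective {a} {b} a<p b<p a≈b with ℕ.≤-total b a
  ... | inj₁ b≤a = ordered-residue-injective b≤a a<p a≈b
  ... | inj₂ a≤b = sym (ordered-residue-injective a≤b b<p (≈-sym a≈b))

  ≈⇒%ℕ≡ : ∀ {a b} → a ≈ b → a %ℕ p ≡ b %ℕ p
  ≈⇒%ℕ≡ {a} {b} a≈b = residue-injective (n%ℕd<d a p) (n%ℕd<d b p)
    (≈-trans (%ℕ-≈ a) (≈-trans a≈b (≈-sym (%ℕ-≈ b))))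

  %ℕ≡⇒≈ : ∀ {a b} → a %ℕ p ≡ b %ℕ p → a ≈ b
  %ℕ≡⇒≈ {a} {b} e = ≈-trans (≈-sym (%ℕ-≈ a)) (≈-trans (≈-reflexive (cong +_ e)) (%ℕ-≈ b))

  positive-residue≉0 : ∀ {n} → 0 ℕ.< n → n ℕ.< p → ¬ + n ≈ + 0
  positive-residue≉0 {suc n} _ n<p n≈0 with residue-injective n<p (ℕ.<-trans (ℕ.s≤s ℕ.z≤n) n<p) n≈0
  ... | ()

prime∤factorial : ∀ {p} → Prime p → ∀ {k} → k ℕ.< p → ¬ p ∣ k !
prime∤factorial p-prime {zero} _ p∣1 =
  ℕ.NonTrivial.nonTrivial (subst ℕ.NonTrivial (∣1⇒≡1 p∣1) (prime⇒nonTrivial p-prime))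
prime∤factorial p-prime {suc k} k<p p∣k! with euclidsLemma (suc k) (k !) p-prime p∣k!
... | inj₁ p∣1+k = ℕ.<⇒≱ k<p (∣⇒≤ p∣1+k)
... | inj₂ p∣k!  = prime∤factorial p-prime (ℕ.<-trans (ℕ.n<1+n k) k<p) p∣k!

prime∣binomial : ∀ {p} → Prime p → ∀ {k} → 0 ℕ.< k → k ℕ.< p → p ∣ p C k
prime∣binomial {p@(suc m)} p-prime {k} 0<k k<p
  with euclidsLemma (p C k) (k ! ℕ.* (p ℕ.∸ k) !) p-prime (subst (p ∣_) (sym p!≡) (m∣m*n (m !)))
  where
  instance _ = ℕ._!*_!≢0 k (p ℕ.∸ k)
  p!≡ : (p C k) ℕ.* (k ! ℕ.* (p ℕ.∸ k) !) ≡ p !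
  p!≡ = trans (cong (ℕ._* (k ! ℕ.* (p ℕ.∸ k) !)) (nCk≡n!/k![n-k]! (ℕ.<⇒≤ k<p)))
              (m/n*n≡m (k![n∸k]!∣n! (ℕ.<⇒≤ k<p)))
... | inj₁ p∣pCk = p∣pCk
... | inj₂ p∣k!*[p-k]! with euclidsLemma (k !) ((p ℕ.∸ k) !) p-prime p∣k!*[p-k]!
...   | inj₁ p∣k!     = ⊥-elim (prime∤factorial p-prime k<p p∣k!)
...   | inj₂ p∣[p-k]! = ⊥-elim (prime∤factorial p-prime (ℕ.∸-monoʳ-< 0<k (ℕ.<⇒≤ k<p)) p∣[p-k]!)

module PrimeModulus {p : ℕ} (p-prime : Prime p) where
  instance
    p≢0 : NonZero p
    p≢0 = prime⇒nonZero p-prime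

  open Congruence p
  open Residues p
  open CommutativeRing ℤ/p using (setoid; commutativeSemiring)
  open import Relation.Binary.Reasoning.Setoid setoid
  open import Algebra.Properties.CommutativeSemiring.Exp commutativeSemiring using (_^_; ^-congˡ; ^-assocʳ)
  open import Algebra.Properties.CommutativeSemiring.Binomial commutativeSemiring using (theorem; binomialTerm)
  open import Algebra.Properties.Monoid.Sum (CommutativeRing.+-monoid ℤ/p) using (sum)

  private
    ≈0⇒∣ : ∀ {a} → a ≈ + 0 → + p Signed.∣ a
    ≈0⇒∣ {a} (mod d) = subst (+ p Signed.∣_) (ℤ.+-identityʳ a) d

    ∣⇒≈0 : ∀ {a} → + p Signed.∣ a → a ≈ + 0
    ∣⇒≈0 {a} d = mod (subst (+ p Signed.∣_) (sym (ℤ.+-identityʳ a)) d)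

  zero-product : ∀ {a b} → a * b ≈ + 0 → a ≈ + 0 ⊎ b ≈ + 0
  zero-product {a} {b} ab≈0
    with euclidsLemma ℤ.∣ a ∣ ℤ.∣ b ∣ p-prime (subst (p ∣_) (ℤ.abs-* a b) (∣⇒∣ᵤ (≈0⇒∣ ab≈0)))
  ... | inj₁ p∣a = inj₁ (∣⇒≈0 (∣ᵤ⇒∣ p∣a))
  ... | inj₂ p∣b = inj₂ (∣⇒≈0 (∣ᵤ⇒∣ p∣b))

  cancelˡ : ∀ {a b} → ¬ a ≈ + 0 → a * b ≈ + 0 → b ≈ + 0
  cancelˡ a≉0 ab≈0 = [ ⊥-elim ∘ a≉0 , id ]′ (zero-product ab≈0)

  square≈0 : ∀ {a} → a * a ≈ + 0 → a ≈ + 0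
  square≈0 aa≈0 = [ id , id ]′ (zero-product aa≈0)

  frobenius : ∀ a b → (a + b) ^ p ≈ b ^ p + a ^ p
  frobenius a b = expand (ℕ.pred p) (ℕ.suc-pred p)
    where
    expand : ∀ m → suc m ≡ p → (a + b) ^ p ≈ b ^ p + a ^ p
    expand m refl = begin
      (a + b) ^ p
        ≈⟨ theorem p a b ⟩
      sum (binomialTerm a b p)
        ≈⟨ sum-with-vanishing-interior (binomialTerm a b p) interior ⟩
      binomialTerm a b p zero + binomialTerm a b p (fromℕ p)
        ≈⟨ +-cong first last ⟩
      b ^ p + a ^ p ∎
      where
      interior : ∀ i → binomialTerm a b p (suc (inject₁ i)) ≈ + 0
      interior i = multiple-·≈0 _ (prime∣binomial p-prime (ℕ.s≤s ℕ.z≤n)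
        (ℕ.s≤s (subst (ℕ._< m) (sym (toℕ-inject₁ i)) (toℕ<n i))))
      first : binomialTerm a b p zero ≈ b ^ p
      first = ≈-reflexive (trans (ℤ.+-identityʳ _) (ℤ.*-identityˡ _))
      last : binomialTerm a b p (fromℕ p) ≈ a ^ p
      last rewrite toℕ-fromℕ m | nCn≡1 p | ℕ.n∸n≡0 m = ≈-reflexive (trans (ℤ.+-identityʳ _) (ℤ.*-identityʳ _))

  fermat-ℕ : ∀ n → (+ n) ^ p ≈ + n
  fermat-ℕ zero    = subst (λ e → (+ 0) ^ e ≈ + 0) (ℕ.suc-pred p) ≈-refl
  fermat-ℕ (suc n) = begin
    (+ 1 + + n) ^ p       ≈⟨ frobenius (+ 1) (+ n) ⟩
    (+ n) ^ p + (+ 1) ^ p ≈⟨ +-cong (fermat-ℕ n) (≈-reflexive (one-power p)) ⟩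
    + n + + 1             ≡⟨ ℤ.+-comm (+ n) (+ 1) ⟩
    + suc n               ∎
    where
    one-power : ∀ e → (+ 1) ^ e ≡ + 1
    one-power zero    = refl
    one-power (suc e) = trans (ℤ.*-identityˡ _) (one-power e)

  fermat : ∀ a → a ^ p ≈ a
  fermat a = begin
    a ^ p              ≈⟨ ^-congˡ p (≈-sym (%ℕ-≈ a)) ⟩
    (+ (a %ℕ p)) ^ p   ≈⟨ fermat-ℕ (a %ℕ p) ⟩
    + (a %ℕ p)         ≈⟨ %ℕ-≈ a ⟩
    a                  ∎

  fermat-unit : ∀ {e} → suc e ≡ p → ∀ {a} → ¬ a ≈ + 0 → a ^ e ≈ + 1
  fermat-unit {e} 1+e≡p {a} a≉0 = difference≈0⇒≈ (cancelˡ a≉0 (begin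
    a * (a ^ e - + 1)   ≡⟨ factor a (a ^ e) ⟩
    a * a ^ e - a       ≡⟨ cong (_- a) (cong (a ^_) 1+e≡p) ⟩
    a ^ p - a           ≈⟨ +-cong (fermat a) (≈-refl { - a}) ⟩
    a - a               ≡⟨ ℤ.+-inverseʳ a ⟩
    + 0                 ∎))
    where
    factor : ∀ a b → a * (b - + 1) ≡ a * b - a
    factor = solve-∀

  sum-of-squares≈0 : ∀ k → p ≡ 3 ℕ.+ 4 ℕ.* k → ∀ a b → a * a + b * b ≈ + 0 → a ≈ + 0
  sum-of-squares≈0 k p≡3+4k a b sum≈0 with a ≈? + 0
  ... | yes a≈0 = a≈0
  ... | no a≉0  = ⊥-elim (positive-residue≉0 (ℕ.s≤s ℕ.z≤n) 2<p (begin
    + 1 + + 1      ≈⟨ +-cong one≈-one (≈-refl {+ 1}) ⟩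
    - + 1 + + 1    ≡⟨ ℤ.+-inverseˡ (+ 1) ⟩
    + 0            ∎))
    where
    m = suc (2 ℕ.* k)
    p≡1+2m : suc (2 ℕ.* m) ≡ p
    p≡1+2m = trans (parity k) (sym p≡3+4k)
      where
      parity : ∀ k → suc (2 ℕ.* suc (2 ℕ.* k)) ≡ 3 ℕ.+ 4 ℕ.* k
      parity = ℕ-Solver.solve-∀
    2<p : 2 ℕ.< p
    2<p = subst (2 ℕ.<_) (sym p≡3+4k) (ℕ.s≤s (ℕ.s≤s (ℕ.s≤s ℕ.z≤n)))
    b≉0 : ¬ b ≈ + 0
    b≉0 b≈0 = a≉0 (square≈0 (begin
      a * a                ≡⟨ ℤ.+-identityʳ (a * a) ⟨
      a * a + + 0 * + 0    ≈⟨ +-cong (≈-refl {a * a}) (*-cong b≈0 b≈0) ⟨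
      a * a + b * b        ≈⟨ sum≈0 ⟩
      + 0                  ∎))
    a²≈-b² : a ^ 2 ≈ - (b ^ 2)
    a²≈-b² = begin
      a ^ 2                    ≡⟨ cong (a *_) (ℤ.*-identityʳ a) ⟩
      a * a                    ≡⟨ rearrange a b ⟩
      (a * a + b * b) - b * b  ≈⟨ +-cong sum≈0 (≈-refl { - (b * b)}) ⟩
      + 0 - b * b              ≡⟨ ℤ.+-identityˡ _ ⟩
      - (b * b)                ≡⟨ cong (λ s → - (b * s)) (ℤ.*-identityʳ b) ⟨
      - (b ^ 2)                ∎
      where
      rearrange : ∀ a b → a * a ≡ (a * a + b * b) - b * b
      rearrange = solve-∀
    one≈-one : + 1 ≈ - + 1
    one≈-one = begin
      + 1                  ≈⟨ fermat-unit p≡1+2m a≉0 ⟨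
      a ^ (2 ℕ.* m)        ≈⟨ ^-assocʳ a 2 m ⟨
      (a ^ 2) ^ m          ≈⟨ ^-congˡ m a²≈-b² ⟩
      (- (b ^ 2)) ^ m      ≈⟨ odd-power-neg (b ^ 2) k ⟩
      - ((b ^ 2) ^ m)      ≈⟨ -‿cong (^-assocʳ b 2 m) ⟩
      - (b ^ (2 ℕ.* m))    ≈⟨ -‿cong (fermat-unit p≡1+2m b≉0) ⟩
      - + 1                ∎

-- The Markoff dynamics over ℤ

Triple : Set
Triple = ℤ × ℤ × ℤ

φℤ : Fin 3 → Triple → Triple
φℤ zero             (x , y , z) = (y * z - x , y , z)
φℤ (suc zero)       (x , y , z) = (x , x * z - y , z)
φℤ (suc (suc zero)) (x , y , z) = (x , y , x * y - z)

fℤ : Fin 3 → Fin 3 → Triple → Triple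
fℤ i j = φℤ i ∘ φℤ j

lift : Pt → Triple
lift (x , y , z) = (+ x , + y , + z)

module Lift (p : ℕ) where
  open Congruence p

  infix 4 _≈³_
  _≈³_ : Triple → Triple → Set
  (x , y , z) ≈³ (x′ , y′ , z′) = (x ≈ x′) × (y ≈ y′) × (z ≈ z′)

  ≈³-reflexive : ∀ {P Q} → P ≡ Q → P ≈³ Q
  ≈³-reflexive refl = ≈-refl , ≈-refl , ≈-refl

  ≈³-sym : ∀ {P Q} → P ≈³ Q → Q ≈³ P
  ≈³-sym (x≈ , y≈ , z≈) = ≈-sym x≈ , ≈-sym y≈ , ≈-sym z≈

  ≈³-trans : ∀ {P Q R} → P ≈³ Q → Q ≈³ R → P ≈³ R
  ≈³-trans (x≈ , y≈ , z≈) (x≈′ , y≈′ , z≈′) = ≈-trans x≈ x≈′ , ≈-trans y≈ y≈′ , ≈-trans z≈ z≈′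

  φℤ-cong : ∀ k {P Q} → P ≈³ Q → φℤ k P ≈³ φℤ k Q
  φℤ-cong zero             (x≈ , y≈ , z≈) = +-cong (*-cong y≈ z≈) (-‿cong x≈) , y≈ , z≈
  φℤ-cong (suc zero)       (x≈ , y≈ , z≈) = x≈ , +-cong (*-cong x≈ z≈) (-‿cong y≈) , z≈
  φℤ-cong (suc (suc zero)) (x≈ , y≈ , z≈) = x≈ , y≈ , +-cong (*-cong x≈ y≈) (-‿cong z≈)

  IsMarkoff : Triple → Set
  IsMarkoff (x , y , z) = x * x + y * y + z * z ≈ x * y * z

  private
    sum-of-squares-cast : ∀ x y z → + (x ℕ.* x ℕ.+ y ℕ.* y ℕ.+ z ℕ.* z) ≡ + x * + x + + y * + y + + z * + z
    sum-of-squares-cast x y z = trans (ℤ.pos-+ (x ℕ.* x ℕ.+ y ℕ.* y) (z ℕ.* z))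
      (cong₂ _+_ (trans (ℤ.pos-+ (x ℕ.* x) (y ℕ.* y)) (cong₂ _+_ (ℤ.pos-* x x) (ℤ.pos-* y y))) (ℤ.pos-* z z))

    product-cast : ∀ x y z → + (x ℕ.* y ℕ.* z) ≡ + x * + y * + z
    product-cast x y z = trans (ℤ.pos-* (x ℕ.* y) z) (cong (_* + z) (ℤ.pos-* x y))

  module _ .{{_ : NonZero p}} where
    open Residues p

    subp-≈ : ∀ a b → + subp p a b ≈ + a - + b
    subp-≈ a b = begin
      + subp p a b               ≈⟨ %ℕ-≈ (+ (a ℕ.+ (p ℕ.∸ b % p))) ⟩
      + (a ℕ.+ (p ℕ.∸ b % p))    ≡⟨ ℤ.pos-+ a (p ℕ.∸ b % p) ⟩
      + a + + (p ℕ.∸ b % p)      ≡⟨ cong (λ s → + a + s) p-b%p≡ ⟨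
      + a + (+ p - + (b % p))    ≈⟨ +-cong (≈-refl {+ a}) (+-cong p≈0 (-‿cong (%ℕ-≈ (+ b)))) ⟩
      + a + (+ 0 - + b)          ≡⟨ cong (λ s → + a + s) (ℤ.+-identityˡ (- + b)) ⟩
      + a - + b                  ∎
      where
      open import Relation.Binary.Reasoning.Setoid (CommutativeRing.setoid ℤ/p)
      p-b%p≡ : + p - + (b % p) ≡ + (p ℕ.∸ b % p)
      p-b%p≡ = trans (ℤ.m-n≡m⊖n p (b % p)) (ℤ.⊖-≥ (ℕ.<⇒≤ (m%n<n b p)))

    lift-φ : ∀ k P → lift (φ p k P) ≈³ φℤ k (lift P)
    lift-φ zero             (x , y , z) =
      ≈-trans (subp-≈ (y ℕ.* z) x) (+-cong (≈-reflexive (ℤ.pos-* y z)) ≈-refl) , %ℕ-≈ (+ y) , %ℕ-≈ (+ z)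
    lift-φ (suc zero)       (x , y , z) =
      %ℕ-≈ (+ x) , ≈-trans (subp-≈ (x ℕ.* z) y) (+-cong (≈-reflexive (ℤ.pos-* x z)) ≈-refl) , %ℕ-≈ (+ z)
    lift-φ (suc (suc zero)) (x , y , z) =
      %ℕ-≈ (+ x) , %ℕ-≈ (+ y) , ≈-trans (subp-≈ (x ℕ.* y) z) (+-cong (≈-reflexive (ℤ.pos-* x y)) ≈-refl)

    lift-iterate : ∀ i j n P → lift (iterate (f p i j) n P) ≈³ iterate (fℤ i j) n (lift P)
    lift-iterate i j zero    P = ≈³-reflexive refl
    lift-iterate i j (suc n) P =
      ≈³-trans (lift-φ i _) (φℤ-cong i (≈³-trans (lift-φ j _) (φℤ-cong j (lift-iterate i j n P))))

    lift-injective : ∀ {P Q} → InFp³ p P → InFp³ p Q → lift P ≈³ lift Q → P ≡ Q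
    lift-injective (x< , y< , z<) (x′< , y′< , z′<) (x≈ , y≈ , z≈) =
      cong₂ _,_ (residue-injective x< x′< x≈)
                (cong₂ _,_ (residue-injective y< y′< y≈) (residue-injective z< z′< z≈))

    φ-InFp³ : ∀ k P → InFp³ p (φ p k P)
    φ-InFp³ zero             _ = m%n<n _ p , m%n<n _ p , m%n<n _ p
    φ-InFp³ (suc zero)       _ = m%n<n _ p , m%n<n _ p , m%n<n _ p
    φ-InFp³ (suc (suc zero)) _ = m%n<n _ p , m%n<n _ p , m%n<n _ p

    OnMarkoff⇒IsMarkoff : ∀ {P} → OnMarkoff p P → IsMarkoff (lift P)
    OnMarkoff⇒IsMarkoff {x , y , z} onM = ≈-trans (≈-reflexive (sym (sum-of-squares-cast x y z)))
      (≈-trans (%ℕ≡⇒≈ onM) (≈-reflexive (product-cast x y z)))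

    IsMarkoff⇒OnMarkoff : ∀ {P} → IsMarkoff (lift P) → OnMarkoff p P
    IsMarkoff⇒OnMarkoff {x , y , z} markoff = ≈⇒%ℕ≡ (≈-trans (≈-reflexive (sum-of-squares-cast x y z))
      (≈-trans markoff (≈-reflexive (sym (product-cast x y z)))))

    periodic⇒lift-periodic : ∀ i j n {P} → iterate (f p i j) n P ≡ P → iterate (fℤ i j) n (lift P) ≈³ lift P
    periodic⇒lift-periodic i j n {P} periodic =
      ≈³-trans (≈³-sym (lift-iterate i j n P)) (≈³-reflexive (cong lift periodic))

    lift-periodic⇒periodic : ∀ i j n {P} → InFp³ p P →
                             iterate (fℤ i j) (suc n) (lift P) ≈³ lift P → iterate (f p i j) (suc n) P ≡ P
    lift-periodic⇒periodic i j n {P} P∈ periodic =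
      lift-injective (φ-InFp³ i _) P∈ (≈³-trans (lift-iterate i j (suc n) P) periodic)

-- Points of period three

module Representation {p : ℕ} (p-prime : Prime p) (h : ℕ) (p≡1+2h : p ≡ suc (h ℕ.+ h)) where
  open Congruence p
  open PrimeModulus p-prime
  open Residues p
  open import Relation.Binary.Reasoning.Setoid (CommutativeRing.setoid ℤ/p)

  private
    sum<p : ∀ {a b} → a ℕ.≤ h → b ℕ.≤ h → a ℕ.+ b ℕ.< p
    sum<p a≤h b≤h = subst (_ ℕ.<_) (sym p≡1+2h) (ℕ.s≤s (ℕ.+-mono-≤ a≤h b≤h))

    ≤h⇒<p : ∀ {a} → a ℕ.≤ h → a ℕ.< p
    ≤h⇒<p a≤h = ℕ.≤-<-trans (ℕ.m≤m+n _ 0) (sum<p a≤h ℕ.z≤n)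

  squares-distinct : ∀ {a b} → a ℕ.< b → b ℕ.≤ h → ¬ + a * + a ≈ + b * + b
  squares-distinct {a} {b} a<b b≤h a²≈b² with zero-product (begin
      (+ b - + a) * (+ b + + a)  ≡⟨ difference-of-squares (+ a) (+ b) ⟩
      + b * + b - + a * + a      ≈⟨ ≈⇒difference≈0 (≈-sym a²≈b²) ⟩
      + 0                        ∎)
    where
    difference-of-squares : ∀ a b → (b - a) * (b + a) ≡ b * b - a * a
    difference-of-squares = solve-∀
  ... | inj₁ b-a≈0 = positive-residue≉0 (ℕ.m<n⇒0<n∸m a<b) (ℕ.≤-<-trans (ℕ.m∸n≤m b a) (≤h⇒<p b≤h))
                       (≈-trans (≈-reflexive (sym (trans (ℤ.m-n≡m⊖n b a) (ℤ.⊖-≥ (ℕ.<⇒≤ a<b))))) b-a≈0)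
  ... | inj₂ b+a≈0 = positive-residue≉0 (ℕ.<-≤-trans (ℕ.≤-<-trans ℕ.z≤n a<b) (ℕ.m≤m+n b a))
                       (sum<p b≤h (ℕ.≤-trans (ℕ.<⇒≤ a<b) b≤h)) b+a≈0

  -- Pigeonhole on the p + 1 values u² and c − a v² with 0 ≤ u, v ≤ h.
  module _ {a : ℤ} (c : ℤ) (a≉0 : ¬ a ≈ + 0) where
    private
      value : ℕ → ℤ
      value n with n ℕ.≤? h
      ... | yes _ = + n * + n
      ... | no _  = c - a * (+ (n ℕ.∸ suc h) * + (n ℕ.∸ suc h))

      residue : Fin (suc p) → Fin p
      residue k = fromℕ< (n%ℕd<d (value (toℕ k)) p)

      shifted≤h : ∀ {n} → n ℕ.≤ p → n ℕ.∸ suc h ℕ.≤ h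
      shifted≤h {n} n≤p = subst (n ℕ.∸ suc h ℕ.≤_) (ℕ.m+n∸m≡n (suc h) h)
        (ℕ.∸-monoˡ-≤ (suc h) (subst (n ℕ.≤_) p≡1+2h n≤p))

      collision : ∀ {k l} → k ℕ.< l → l ℕ.≤ p → value k ≈ value l → ∃₂ λ u v → u * u + a * (v * v) ≈ c
      collision {k} {l} k<l l≤p k~l with k ℕ.≤? h | l ℕ.≤? h
      ... | yes _   | yes l≤h = ⊥-elim (squares-distinct k<l l≤h k~l)
      ... | no k≰h  | yes l≤h = ⊥-elim (k≰h (ℕ.≤-trans (ℕ.<⇒≤ k<l) l≤h))
      ... | yes _   | no _    = + k , + w , (begin
        + k * + k + a * (+ w * + w)              ≈⟨ +-cong k~l (≈-refl {a * (+ w * + w)}) ⟩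
        c - a * (+ w * + w) + a * (+ w * + w)    ≡⟨ cancel c (a * (+ w * + w)) ⟩
        c                                        ∎)
        where
        w = l ℕ.∸ suc h
        cancel : ∀ c d → c - d + d ≡ c
        cancel = solve-∀
      ... | no k≰h  | no _    = ⊥-elim (squares-distinct (ℕ.∸-monoˡ-< k<l (ℕ.≰⇒> k≰h)) (shifted≤h l≤p)
        (≈-sym (difference≈0⇒≈ (cancelˡ a≉0 (begin
          a * (W - V)                ≡⟨ factor a c V W ⟩
          (c - a * V) - (c - a * W)  ≈⟨ ≈⇒difference≈0 k~l ⟩
          + 0                        ∎)))))
        where
        V = + (k ℕ.∸ suc h) * + (k ℕ.∸ suc h)
        W = + (l ℕ.∸ suc h) * + (l ℕ.∸ suc h)
        factor : ∀ a c V W → a * (W - V) ≡ (c - a * V) - (c - a * W)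
        factor = solve-∀

    represents : ∃₂ λ u v → u * u + a * (v * v) ≈ c
    represents with pigeonhole (ℕ.n<1+n p) residue
    ... | k , l , k<l , same-residue = collision k<l (ℕ.≤-pred (toℕ<n l))
      (%ℕ≡⇒≈ (trans (sym (toℕ-fromℕ< _)) (trans (cong toℕ same-residue) (toℕ-fromℕ< _))))

  -- h + 1 inverts 2, so x = (u + v)/2 and y = v; then 4(x² + y² + 1 − xy) = u² + 3v² + 4.
  halving-solves-conic : 2 ℕ.< p → ∀ u v → u * u + + 3 * (v * v) ≈ - + 4 →
                         let x = (u + v) * + suc h in x * x + v * v + + 1 ≈ x * v
  halving-solves-conic 2<p u v norm≈-4 = difference≈0⇒≈ {x * x + v * v + + 1} {x * v}
    (cancelˡ {+ 2} {x * x + v * v + + 1 - x * v} two≉0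
      (cancelˡ {+ 2} {+ 2 * (x * x + v * v + + 1 - x * v)} two≉0 (begin
        + 2 * (+ 2 * (x * x + v * v + + 1 - x * v))
          ≡⟨ complete-square x v ⟩
        (+ 2 * x - v) * (+ 2 * x - v) + (+ 3 * (v * v) + + 4)
          ≈⟨ +-cong (*-cong 2x-v≈u 2x-v≈u) (≈-refl {+ 3 * (v * v) + + 4}) ⟩
        u * u + (+ 3 * (v * v) + + 4)
          ≡⟨ ℤ.+-assoc (u * u) (+ 3 * (v * v)) (+ 4) ⟨
        u * u + + 3 * (v * v) + + 4
          ≈⟨ +-cong norm≈-4 (≈-refl {+ 4}) ⟩
        + 0 ∎)))
    where
    two≉0 : ¬ + 2 ≈ + 0
    two≉0 = positive-residue≉0 (ℕ.s≤s ℕ.z≤n) 2<p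
    x : ℤ
    x = (u + v) * + suc h
    complete-square : ∀ x v → + 2 * (+ 2 * (x * x + v * v + + 1 - x * v)) ≡
                              (+ 2 * x - v) * (+ 2 * x - v) + (+ 3 * (v * v) + + 4)
    complete-square = solve-∀
    halve : ∀ u v H → + 2 * ((u + v) * (+ 1 + H)) - v ≡ u + (u + v) * (+ 1 + (H + H))
    halve = solve-∀
    2x-v≈u : + 2 * x - v ≈ u
    2x-v≈u = begin
      + 2 * x - v                    ≡⟨ halve u v (+ h) ⟩
      u + (u + v) * + suc (h ℕ.+ h)  ≡⟨ cong (λ n → u + (u + v) * + n) (sym p≡1+2h) ⟩
      u + (u + v) * + p              ≈⟨ +-cong (≈-refl {u}) (multiple≈0 (u + v)) ⟩
      u + + 0                        ≡⟨ ℤ.+-identityʳ u ⟩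
      u                              ∎

  conic-point : 3 ℕ.< p → ∃₂ λ x y → x * x + y * y + + 1 ≈ x * y
  conic-point 3<p =
    let u , v , norm≈-4 = represents {+ 3} (- + 4) (positive-residue≉0 (ℕ.s≤s ℕ.z≤n) 3<p)
    in (u + v) * + suc h , v , halving-solves-conic (ℕ.<-trans (ℕ.n<1+n 2) 3<p) u v norm≈-4

rotation : ∀ X Y → fℤ 0F 1F (X , Y , + 1) ≡ (- Y , X - Y , + 1)
rotation X Y = cong₂ _,_ (first X Y) (cong₂ _,_ (second X Y) refl)
  where
  first : ∀ X Y → (X * + 1 - Y) * + 1 - X ≡ - Y
  first = solve-∀
  second : ∀ X Y → X * + 1 - Y ≡ X - Y
  second = solve-∀

order-three : ∀ X Y → iterate (fℤ 0F 1F) 3 (X , Y , + 1) ≡ (X , Y , + 1)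
order-three X Y = begin
  g (g (g (X , Y , + 1)))
    ≡⟨ cong (g ∘ g) (rotation X Y) ⟩
  g (g (- Y , X - Y , + 1))
    ≡⟨ cong g (rotation (- Y) (X - Y)) ⟩
  g (- (X - Y) , - Y - (X - Y) , + 1)
    ≡⟨ rotation (- (X - Y)) (- Y - (X - Y)) ⟩
  (- (- Y - (X - Y)) , - (X - Y) - (- Y - (X - Y)) , + 1)
    ≡⟨ cong₂ _,_ (first X Y) (cong₂ _,_ (second X Y) refl) ⟩
  (X , Y , + 1) ∎
  where
  open ≡-Reasoning
  g : Triple → Triple
  g = fℤ 0F 1F
  first : ∀ X Y → - (- Y - (X - Y)) ≡ X
  first = solve-∀
  second : ∀ X Y → - (X - Y) - (- Y - (X - Y)) ≡ Y
  second = solve-∀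

module PeriodThree {p : ℕ} (p-prime : Prime p) (h : ℕ) (p≡1+2h : p ≡ suc (h ℕ.+ h)) (3<p : 3 ℕ.< p) where
  open Congruence p
  open PrimeModulus p-prime
  open Residues p
  open Lift p
  open Representation p-prime h p≡1+2h
  open import Relation.Binary.Reasoning.Setoid (CommutativeRing.setoid ℤ/p)

  conic-point-has-period-three : ∀ x y → x * x + y * y + + 1 ≈ x * y → HasGoodPeriodicPoint 3 p 0F 1F
  conic-point-has-period-three x y conic =
    P , P∈ , IsMarkoff⇒OnMarkoff {P} markoff , (λ ()) , 3 , ℕ.s≤s ℕ.z≤n , ℕ.≤-refl ,
    lift-periodic⇒periodic 0F 1F 2 P∈ (≈³-reflexive (order-three X Y))
    where
    P : Pt
    P = x %ℕ p , y %ℕ p , 1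
    P∈ : InFp³ p P
    P∈ = n%ℕd<d x p , n%ℕd<d y p , ℕ.<-trans (ℕ.n<1+n 1) (ℕ.<-trans (ℕ.n<1+n 2) 3<p)
    X Y : ℤ
    X = + (x %ℕ p)
    Y = + (y %ℕ p)
    markoff : IsMarkoff (lift P)
    markoff = begin
      X * X + Y * Y + + 1 * + 1
        ≈⟨ +-cong (+-cong (*-cong (%ℕ-≈ x) (%ℕ-≈ x)) (*-cong (%ℕ-≈ y) (%ℕ-≈ y))) (≈-refl {+ 1}) ⟩
      x * x + y * y + + 1
        ≈⟨ conic ⟩
      x * y
        ≈⟨ *-cong (%ℕ-≈ x) (%ℕ-≈ y) ⟨
      X * Y
        ≡⟨ ℤ.*-identityʳ (X * Y) ⟨
      X * Y * + 1 ∎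

  period-three-point : HasGoodPeriodicPoint 3 p 0F 1F
  period-three-point = let x , y , conic = conic-point 3<p in conic-point-has-period-three x y conic

odd-prime : ∀ {p} → Prime p → p ≢ 2 → ∃ λ h → p ≡ suc (h ℕ.+ h)
odd-prime {p} p-prime p≢2 with p % 2 | m%n<n p 2 | m≡m%n+[m/n]*n p 2
... | 0 | _ | p≡[p/2]*2 =
  ⊥-elim ([ (λ ()) , (λ 2≡p → p≢2 (sym 2≡p)) ]′ (prime⇒irreducible p-prime (divides (p / 2) p≡[p/2]*2)))
... | suc (suc _) | ℕ.s≤s (ℕ.s≤s ()) | _
... | 1 | _ | p≡1+[p/2]*2 = p / 2 , trans p≡1+[p/2]*2 (double (p / 2))
  where
  double : ∀ h → 1 ℕ.+ h ℕ.* 2 ≡ suc (h ℕ.+ h)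
  double = ℕ-Solver.solve-∀

SRP-3 : SRP 3 0F 1F
SRP-3 = 2 ∷ 3 ∷ [] , two-three-prime , period-three-outside
  where
  two-three-prime : ∀ q → q ∈ 2 ∷ 3 ∷ [] → Prime q
  two-three-prime _ (here refl)         = prime[2]
  two-three-prime _ (there (here refl)) = from-yes (prime? 3)
  period-three-outside : (p : ℕ) (p-prime : Prime p) → ¬ p ∈ 2 ∷ 3 ∷ [] →
                         HasGoodPeriodicPoint 3 p {{prime⇒nonZero p-prime}} 0F 1F
  period-three-outside p p-prime p∉ =
    let h , p≡1+2h = odd-prime p-prime (λ p≡2 → p∉ (here p≡2))
    in PeriodThree.period-three-point p-prime h p≡1+2h 3<p
    where
    2<p : 2 ℕ.< p
    2<p = ℕ.≤∧≢⇒< (ℕ.nonTrivial⇒n>1 p {{prime⇒nonTrivial p-prime}}) (λ 2≡p → p∉ (here (sym 2≡p)))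
    3<p : 3 ℕ.< p
    3<p = ℕ.≤∧≢⇒< 2<p (λ 3≡p → p∉ (there (here (sym 3≡p))))

-- No points of period two

module PeriodTwo {p : ℕ} (p-prime : Prime p) (k : ℕ) (p≡3+4k : p ≡ 3 ℕ.+ 4 ℕ.* k) where
  open Congruence p
  open PrimeModulus p-prime
  open Residues p
  open Lift p
  open import Relation.Binary.Reasoning.Setoid (CommutativeRing.setoid ℤ/p)

  two≉0 : ¬ + 2 ≈ + 0
  two≉0 = positive-residue≉0 (ℕ.s≤s ℕ.z≤n) (subst (2 ℕ.<_) (sym p≡3+4k) (ℕ.s≤s (ℕ.s≤s (ℕ.s≤s ℕ.z≤n))))

  -- With t = c² − 2, Cayley–Hamilton gives f² P − P = t f(P) − 2 P on the (x, y) coordinates;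
  -- these are two combinations of its components.
  period-two-equations : ∀ {x y c} → iterate (fℤ 0F 1F) 2 (x , y , c) ≈³ (x , y , c) →
                         c * (+ 2 * y - c * x) ≈ + 0 × c * ((c * c - + 2) * x - c * y) ≈ + 0
  period-two-equations {x} {y} {c} (x₂≈x , y₂≈y , _) =
    (begin
      c * (+ 2 * y - c * x)
        ≡⟨ first x y c ⟩
      dx - c * dy
        ≈⟨ +-cong (≈⇒difference≈0 x₂≈x) (-‿cong (*-cong (≈-refl {c}) (≈⇒difference≈0 y₂≈y))) ⟩
      + 0 - c * + 0
        ≡⟨ cong (λ s → + 0 - s) (ℤ.*-zeroʳ c) ⟩
      + 0 ∎) ,
    (begin
      c * ((c * c - + 2) * x - c * y) ≡⟨ second x y c ⟩
      dy                              ≈⟨ ≈⇒difference≈0 y₂≈y ⟩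
      + 0                             ∎)
    where
    dx dy : ℤ
    dx = ((((x * c - y) * c - x) * c - (x * c - y)) * c - ((x * c - y) * c - x)) - x
    dy = (((x * c - y) * c - x) * c - (x * c - y)) - y
    first : ∀ x y c → c * (+ 2 * y - c * x) ≡
            (((((x * c - y) * c - x) * c - (x * c - y)) * c - ((x * c - y) * c - x)) - x)
              - c * ((((x * c - y) * c - x) * c - (x * c - y)) - y)
    first = solve-∀
    second : ∀ x y c → c * ((c * c - + 2) * x - c * y) ≡ (((x * c - y) * c - x) * c - (x * c - y)) - y
    second = solve-∀

  markoff-plane : ∀ x y c → IsMarkoff (x , y , c) → c ≈ + 0 → x * x + y * y ≈ + 0
  markoff-plane x y c markoff c≈0 = begin
    x * x + y * y
      ≡⟨ split x y c ⟩
    (x * x + y * y + c * c - x * y * c) + c * (x * y - c)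
      ≈⟨ +-cong (≈⇒difference≈0 markoff) (*-cong c≈0 (≈-refl {x * y - c})) ⟩
    + 0 ∎
    where
    split : ∀ x y c → x * x + y * y ≡ (x * x + y * y + c * c - x * y * c) + c * (x * y - c)
    split = solve-∀

  no-period-two-off-plane : ∀ x y c → IsMarkoff (x , y , c) →
                            iterate (fℤ 0F 1F) 2 (x , y , c) ≈³ (x , y , c) → ¬ c ≈ + 0 → ⊥
  no-period-two-off-plane x y c markoff periodic c≉0 = [ c²≈4-case , x≈0-case ]′ (zero-product Qx≈0)
    where
    B≈0 : + 2 * y - c * x ≈ + 0
    B≈0 = cancelˡ c≉0 (proj₁ (period-two-equations periodic))
    A≈0 : (c * c - + 2) * x - c * y ≈ + 0
    A≈0 = cancelˡ c≉0 (proj₂ (period-two-equations periodic))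
    M≈0 : x * x + y * y + c * c - x * y * c ≈ + 0
    M≈0 = ≈⇒difference≈0 markoff

    Qx≈0 : (c * c - + 4) * x ≈ + 0
    Qx≈0 = begin
      (c * c - + 4) * x
        ≡⟨ combine x y c ⟩
      + 2 * ((c * c - + 2) * x - c * y) + c * (+ 2 * y - c * x)
        ≈⟨ +-cong (*-cong (≈-refl {+ 2}) A≈0) (*-cong (≈-refl {c}) B≈0) ⟩
      + 2 * + 0 + c * + 0
        ≡⟨ cong (λ s → + 0 + s) (ℤ.*-zeroʳ c) ⟩
      + 0 ∎
      where
      combine : ∀ x y c → (c * c - + 4) * x ≡ + 2 * ((c * c - + 2) * x - c * y) + c * (+ 2 * y - c * x)
      combine = solve-∀

    -- Using 2y = cx and c² = 4, four times the Markoff equation collapses to 16 = 0.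
    c²≈4-case : c * c - + 4 ≈ + 0 → ⊥
    c²≈4-case Q≈0 = two≉0 (cancelˡ {+ 2} two≉0 (cancelˡ {+ 2} two≉0 (cancelˡ {+ 2} two≉0 (begin
      + 16                                                                ≡⟨ sixteen x y c ⟩
      + 4 * (x * x + y * y + c * c - x * y * c) + (c * c - + 4) * (x * x)
        - (+ 2 * y - c * x) * (+ 2 * y - c * x) - + 4 * (c * c - + 4)
        ≈⟨ +-cong (+-cong (+-cong (*-cong (≈-refl {+ 4}) M≈0) (*-cong Q≈0 (≈-refl {x * x})))
                          (-‿cong (*-cong B≈0 B≈0))) (-‿cong (*-cong (≈-refl {+ 4}) Q≈0)) ⟩
      + 0                                                                 ∎))))
      where
      sixteen : ∀ x y c → + 16 ≡ + 4 * (x * x + y * y + c * c - x * y * c) + (c * c - + 4) * (x * x)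
                                  - (+ 2 * y - c * x) * (+ 2 * y - c * x) - + 4 * (c * c - + 4)
      sixteen = solve-∀

    x≈0-case : x ≈ + 0 → ⊥
    x≈0-case x≈0 = c≉0 (square≈0 (begin
      c * c
        ≡⟨ isolate x y c ⟩
      (x * x + y * y + c * c - x * y * c) - x * (x - y * c) - y * y
        ≈⟨ +-cong (+-cong M≈0 (-‿cong (*-cong x≈0 (≈-refl {x - y * c})))) (-‿cong (*-cong y≈0 y≈0)) ⟩
      + 0 ∎))
      where
      isolate : ∀ x y c → c * c ≡ (x * x + y * y + c * c - x * y * c) - x * (x - y * c) - y * y
      isolate = solve-∀
      y≈0 : y ≈ + 0
      y≈0 = cancelˡ two≉0 (begin
        + 2 * y                     ≡⟨ shift x y c ⟩
        (+ 2 * y - c * x) + c * x   ≈⟨ +-cong B≈0 (*-cong (≈-refl {c}) x≈0) ⟩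
        + 0 + c * + 0               ≡⟨ cong (λ s → + 0 + s) (ℤ.*-zeroʳ c) ⟩
        + 0                         ∎)
        where
        shift : ∀ x y c → + 2 * y ≡ (+ 2 * y - c * x) + c * x
        shift = solve-∀

  period-two-trivial : ∀ x y c → IsMarkoff (x , y , c) →
                       iterate (fℤ 0F 1F) 2 (x , y , c) ≈³ (x , y , c) → (x , y , c) ≈³ (+ 0 , + 0 , + 0)
  period-two-trivial x y c markoff periodic with c ≈? + 0
  ... | no c≉0  = ⊥-elim (no-period-two-off-plane x y c markoff periodic c≉0)
  ... | yes c≈0 = sum-of-squares≈0 k p≡3+4k x y x²+y²≈0 ,
                  sum-of-squares≈0 k p≡3+4k y x (≈-trans (≈-reflexive (ℤ.+-comm (y * y) (x * x))) x²+y²≈0) , c≈0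
    where
    x²+y²≈0 : x * x + y * y ≈ + 0
    x²+y²≈0 = markoff-plane x y c markoff c≈0

period-two : ∀ {A : Set} (g : A → A) {a} n → 1 ℕ.≤ n → n ℕ.≤ 2 → iterate g n a ≡ a → iterate g 2 a ≡ a
period-two g 1 _ _ periodic = trans (cong g periodic) periodic
period-two g 2 _ _ periodic = periodic
period-two g (suc (suc (suc _))) _ (ℕ.s≤s (ℕ.s≤s ())) _

no-period-two-point : ∀ {p} (p-prime : Prime p) k → p ≡ 3 ℕ.+ 4 ℕ.* k →
                      ¬ HasGoodPeriodicPoint 2 p {{prime⇒nonZero p-prime}} 0F 1F
no-period-two-point {p} p-prime k p≡3+4k ((x , y , z) , P∈ , onM , P≢0 , n , 1≤n , n≤2 , periodic) =
  P≢0 (lift-injective P∈ 0∈ (period-two-trivial (+ x) (+ y) (+ z) (OnMarkoff⇒IsMarkoff {x , y , z} onM)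
                               (periodic⇒lift-periodic 0F 1F 2 (period-two (f p 0F 1F) n 1≤n n≤2 periodic))))
  where
  open PrimeModulus p-prime
  open Lift p
  open PeriodTwo p-prime k p≡3+4k
  0∈ : InFp³ p (0 , 0 , 0)
  0∈ = let 0<p = ℕ.>-nonZero⁻¹ p in 0<p , 0<p , 0<p

product≡3-mod-4 : ∀ {r s} → r ℕ.< 4 → s ℕ.< 4 → (r ℕ.* s) % 4 ≡ 3 → r ≡ 3 ⊎ s ≡ 3
product≡3-mod-4 {3} _ _ _ = inj₁ refl
product≡3-mod-4 {_} {3} _ _ _ = inj₂ refl
product≡3-mod-4 {0} {0} _ _ ()
product≡3-mod-4 {0} {1} _ _ ()
product≡3-mod-4 {0} {2} _ _ ()
product≡3-mod-4 {1} {0} _ _ ()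
product≡3-mod-4 {1} {1} _ _ ()
product≡3-mod-4 {1} {2} _ _ ()
product≡3-mod-4 {2} {0} _ _ ()
product≡3-mod-4 {2} {1} _ _ ()
product≡3-mod-4 {2} {2} _ _ ()
product≡3-mod-4 {suc (suc (suc (suc _)))} (ℕ.s≤s (ℕ.s≤s (ℕ.s≤s (ℕ.s≤s ())))) _ _
product≡3-mod-4 {_} {suc (suc (suc (suc _)))} _ (ℕ.s≤s (ℕ.s≤s (ℕ.s≤s (ℕ.s≤s ())))) _

factor≡3-mod-4 : ∀ ns → product ns % 4 ≡ 3 → ∃ λ n → n ∈ ns × n % 4 ≡ 3
factor≡3-mod-4 (n ∷ ns) n*ns≡3
  with product≡3-mod-4 (m%n<n n 4) (m%n<n (product ns) 4) (trans (sym (%-distribˡ-* n (product ns) 4)) n*ns≡3)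
... | inj₁ n≡3  = n , here refl , n≡3
... | inj₂ ns≡3 = let m , m∈ns , m≡3 = factor≡3-mod-4 ns ns≡3 in m , there m∈ns , m≡3

prime≡3-mod-4-outside : ∀ S → All.All Prime S → ∃ λ q → Prime q × ¬ q ∈ S × q % 4 ≡ 3
prime≡3-mod-4-outside S S-primes = q , q-prime , q∉S , proj₂ (proj₂ factor)
  where
  r = ℕ.pred (product S)
  S≡1+r : product S ≡ suc r
  S≡1+r = sym (ℕ.suc-pred (product S) {{ℕ.>-nonZero (productOfPrimes≥1 S-primes)}})
  N = 3 ℕ.+ r ℕ.* 4
  open PrimeFactorisation (factorise N)
  factor : ∃ λ n → n ∈ factors × n % 4 ≡ 3
  factor = factor≡3-mod-4 factors (trans (cong (_% 4) (sym isFactorisation)) ([m+kn]%n≡m%n 3 r 4))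
  q = proj₁ factor
  q-prime : Prime q
  q-prime = All.lookup factorsPrime (proj₁ (proj₂ factor))
  q∣N : q ∣ N
  q∣N = subst (q ∣_) (sym isFactorisation) (∈⇒∣product (proj₁ (proj₂ factor)))
  q∉S : ¬ q ∈ S
  q∉S q∈S = ℕ.NonTrivial.nonTrivial
    (subst ℕ.NonTrivial (∣1⇒≡1 (∣m+n∣m⇒∣n q∣N+1 q∣N)) (prime⇒nonTrivial q-prime))
    where
    four-times : ∀ r → suc r ℕ.* 4 ≡ 3 ℕ.+ r ℕ.* 4 ℕ.+ 1
    four-times = ℕ-Solver.solve-∀
    q∣N+1 : q ∣ N ℕ.+ 1
    q∣N+1 = subst (q ∣_) (four-times r) (∣m⇒∣m*n 4 (subst (q ∣_) S≡1+r (∈⇒∣product q∈S)))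

no-SRP-2 : ¬ SRP 2 0F 1F
no-SRP-2 (S , S-primes , period-two-outside) =
  let q , q-prime , q∉S , q≡3 = prime≡3-mod-4-outside S (All.tabulate (S-primes _))
  in no-period-two-point q-prime (q / 4) (q≡3+4[q/4] q q≡3) (period-two-outside q q-prime q∉S)
  where
  q≡3+4[q/4] : ∀ q → q % 4 ≡ 3 → q ≡ 3 ℕ.+ 4 ℕ.* (q / 4)
  q≡3+4[q/4] q q≡3 = trans (m≡m%n+[m/n]*n q 4) (cong₂ ℕ._+_ q≡3 (ℕ.*-comm (q / 4) 4))

-- Relabelling the coordinates

record CoordinatePermutation : Set where
  field
    permute           : Pt → Pt
    relabel           : Fin 3 → Fin 3
    permute-∈         : ∀ {p P} → InFp³ p P → InFp³ p (permute P)
    permute-OnMarkoff : ∀ {p} .{{_ : NonZero p}} {P} → OnMarkoff p P → OnMarkoff p (permute P)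
    permute-origin    : ∀ {P} → permute P ≡ (0 , 0 , 0) → P ≡ (0 , 0 , 0)
    φ-permute         : ∀ {p} .{{_ : NonZero p}} k P → φ p (relabel k) (permute P) ≡ permute (φ p k P)

module _ (π : CoordinatePermutation) where
  open CoordinatePermutation π

  iterate-permute : ∀ {p} .{{_ : NonZero p}} i j n P →
                    iterate (f p (relabel i) (relabel j)) n (permute P) ≡ permute (iterate (f p i j) n P)
  iterate-permute {p} i j zero    P = refl
  iterate-permute {p} i j (suc n) P =
    trans (cong (φ p (relabel i) ∘ φ p (relabel j)) (iterate-permute i j n P))
          (trans (cong (φ p (relabel i)) (φ-permute j _)) (φ-permute i _))

  HasGoodPeriodicPoint-permute : ∀ {B p} .{{_ : NonZero p}} {i j} →
                                 HasGoodPeriodicPoint B p i j → HasGoodPeriodicPoint B p (relabel i) (relabel j)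
  HasGoodPeriodicPoint-permute {i = i} {j} (P , P∈ , onM , P≢0 , n , 1≤n , n≤B , periodic) =
    permute P , permute-∈ {P = P} P∈ , permute-OnMarkoff {P = P} onM , P≢0 ∘ permute-origin , n , 1≤n , n≤B ,
    trans (iterate-permute i j n P) (cong permute periodic)

  SRP-permute : ∀ {B} i j → SRP B i j → SRP B (relabel i) (relabel j)
  SRP-permute _ _ (S , S-primes , good) =
    S , S-primes , λ p p-prime p∉S → HasGoodPeriodicPoint-permute {{prime⇒nonZero p-prime}} (good p p-prime p∉S)

swap₀₁ : CoordinatePermutation
swap₀₁ = record
  { permute = σ ; relabel = τ ; permute-∈ = λ { (x< , y< , z<) → y< , x< , z< }
  ; permute-OnMarkoff = λ {P = P} → σ-OnMarkoff {P = P} ; permute-origin = λ { refl → refl } ; φ-permute = φ-σ }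
  where
  σ : Pt → Pt
  σ (x , y , z) = y , x , z
  τ : Fin 3 → Fin 3
  τ 0F = 1F
  τ 1F = 0F
  τ 2F = 2F
  σ-OnMarkoff : ∀ {p} .{{_ : NonZero p}} {P} → OnMarkoff p P → OnMarkoff p (σ P)
  σ-OnMarkoff {p} {x , y , z} = subst₂ (λ s t → s % p ≡ t % p) (squares x y z) (cube x y z)
    where
    squares : ∀ x y z → x ℕ.* x ℕ.+ y ℕ.* y ℕ.+ z ℕ.* z ≡ y ℕ.* y ℕ.+ x ℕ.* x ℕ.+ z ℕ.* z
    squares = ℕ-Solver.solve-∀
    cube : ∀ x y z → x ℕ.* y ℕ.* z ≡ y ℕ.* x ℕ.* z
    cube = ℕ-Solver.solve-∀
  φ-σ : ∀ {p} .{{_ : NonZero p}} k P → φ p (τ k) (σ P) ≡ σ (φ p k P)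
  φ-σ     0F _           = refl
  φ-σ     1F _           = refl
  φ-σ {p} 2F (x , y , z) = cong (λ m → y % p , x % p , subp p m z) (ℕ.*-comm y x)

swap₁₂ : CoordinatePermutation
swap₁₂ = record
  { permute = σ ; relabel = τ ; permute-∈ = λ { (x< , y< , z<) → x< , z< , y< }
  ; permute-OnMarkoff = λ {P = P} → σ-OnMarkoff {P = P} ; permute-origin = λ { refl → refl } ; φ-permute = φ-σ }
  where
  σ : Pt → Pt
  σ (x , y , z) = x , z , y
  τ : Fin 3 → Fin 3
  τ 0F = 0F
  τ 1F = 2F
  τ 2F = 1F
  σ-OnMarkoff : ∀ {p} .{{_ : NonZero p}} {P} → OnMarkoff p P → OnMarkoff p (σ P)
  σ-OnMarkoff {p} {x , y , z} = subst₂ (λ s t → s % p ≡ t % p) (squares x y z) (cube x y z)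
    where
    squares : ∀ x y z → x ℕ.* x ℕ.+ y ℕ.* y ℕ.+ z ℕ.* z ≡ x ℕ.* x ℕ.+ z ℕ.* z ℕ.+ y ℕ.* y
    squares = ℕ-Solver.solve-∀
    cube : ∀ x y z → x ℕ.* y ℕ.* z ≡ x ℕ.* z ℕ.* y
    cube = ℕ-Solver.solve-∀
  φ-σ : ∀ {p} .{{_ : NonZero p}} k P → φ p (τ k) (σ P) ≡ σ (φ p k P)
  φ-σ {p} 0F (x , y , z) = cong (λ m → subp p m x , z % p , y % p) (ℕ.*-comm z y)
  φ-σ     1F _           = refl
  φ-σ     2F _           = refl

pair-independent : ∀ {B} i j → i ≢ j → SRP B 0F 1F ⇔ SRP B i j
pair-independent 0F 0F i≢j = ⊥-elim (i≢j refl)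
pair-independent 0F 1F _   = mk⇔ id id
pair-independent 0F 2F _   = mk⇔ (SRP-permute swap₁₂ 0F 1F) (SRP-permute swap₁₂ 0F 2F)
pair-independent 1F 0F _   = mk⇔ (SRP-permute swap₀₁ 0F 1F) (SRP-permute swap₀₁ 1F 0F)
pair-independent 1F 1F i≢j = ⊥-elim (i≢j refl)
pair-independent 1F 2F _   =
  mk⇔ (SRP-permute swap₀₁ 0F 2F ∘ SRP-permute swap₁₂ 0F 1F)
      (SRP-permute swap₁₂ 0F 2F ∘ SRP-permute swap₀₁ 1F 2F)
pair-independent 2F 0F _   =
  mk⇔ (SRP-permute swap₁₂ 1F 0F ∘ SRP-permute swap₀₁ 0F 1F)
      (SRP-permute swap₀₁ 1F 0F ∘ SRP-permute swap₁₂ 2F 0F)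
pair-independent 2F 1F _   =
  mk⇔ (SRP-permute swap₁₂ 1F 2F ∘ SRP-permute swap₀₁ 0F 2F ∘ SRP-permute swap₁₂ 0F 1F)
      (SRP-permute swap₁₂ 0F 2F ∘ SRP-permute swap₀₁ 1F 2F ∘ SRP-permute swap₁₂ 2F 1F)
pair-independent 2F 2F i≢j = ⊥-elim (i≢j refl)

theorem1p2 : (i j : Fin 3) → ¬ (i ≡ j) →
    SRP 3 i j × ¬ SRP 2 i j
theorem1p2 i j i≢j =
  to (pair-independent i j i≢j) SRP-3 , λ srp → no-SRP-2 (from (pair-independent i j i≢j) srp)
  where open Equivalence
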